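{- Let $G=(V\cup\{s\},E)$ be a finite, connected, undirected, loop-free graph (multiple edges allowed) with sink $s\notin V$, and let $p\in(0,1)$. Then $\mathcal{V}(G)\subseteq{\sf Sto}(G)$, where $\mathcal{V}(G)=\bigcup_O{\sf comp}(O)$ is the set of stable configurations compatible with some orientation $O$ of $G$.
   Context: $d^G(v)$ is degree with multiplicity. Configurations $\eta\in\mathbb{Z}_{\ge0}^V$, stable if $\eta_v\le d^G(v)$ for all $v\in V$; $\eta^{\max}=(d^G(v))_{v\in V}$. In the stochastic sandpile model with parameter $p$, a legal stochastic toppling at $x\in V$ (allowed when $\eta_x>d^G(x)$) chooses independently for each edge $e=\{x,y\}$ at $x$ a Bernoulli($p$) variable $B_e$, removes $\sum_eB_e$ grains from $x$ and adds $B_e$ grains to $y$ if $y\ne s$. The Markov chain on stable configurations adds one grain at a random vertex of $V$ (distribution with support $V$), then performs legal stochastic topplings until stable; ${\sf Sto}(G)$ is its recurrent class containing $\eta^{\max}$. An orientation of $G$ orients every edge of $E$ (parallel edges independently); ${\sf in}_O(v)$ is the number of edges oriented into $v$. With $l_\eta(v)=d^G(v)-\eta_v$, $\eta$ is compatible with $O$ if ${\sf in}_O(v)\ge1+l_\eta(v)$ for all $v\in V$; ${\sf comp}(O)$ is the set of stable configurations compatible with $O$. -}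

module Defs where

open import Data.Nat using (ℕ; zero; suc; _+_; _*_; _∸_; _≤_; _<_)
open import Data.Fin using (Fin; zero; suc; _≟_)
open import Data.Bool using (Bool; true; false; if_then_else_)
open import Data.Product using (_×_; _,_; proj₁; proj₂; Σ; ∃; ∃-syntax)
open import Data.Sum using (_⊎_)
open import Relation.Binary.PropositionalEquality using (_≡_; _≢_)
open import Relation.Nullary using (Dec; yes; no; does)
open import Relation.Binary.Construct.Closure.ReflexiveTransitive using (Star)

Σᶠ : ∀ {m} → (Fin m → ℕ) → ℕ
Σᶠ {zero}  f = 0
Σᶠ {suc m} f = f zero + Σᶠ (λ i → f (suc i))

[_] : Bool → ℕ
[ true ]  = 1
[ false ] = 0

_==_ : ∀ {k} → Fin k → Fin k → Bool
a == b = does (a ≟ b)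

_∧_ : Bool → Bool → Bool
true ∧ b = b
false ∧ b = false

_∨_ : Bool → Bool → Bool
true ∨ b = true
false ∨ b = b

-- A finite multigraph G = (V ∪ {s}, E):
--   vertices Fin (suc n); the sink s is `zero`, the non-sink vertex v ∈ V = Fin n
--   is represented by `suc v`;  edges are indexed by Fin m, edge e has endpoints ends e.
--   Parallel edges = distinct indices with the same endpoints.
record Graph : Set where
  field
    n    : ℕ
    m    : ℕ
    ends : Fin m → Fin (suc n) × Fin (suc n)

module _ (G : Graph) where
  open Graph G

  Vtx : Set
  Vtx = Fin (suc n)

  sink : Vtx
  sink = zero

  LoopFree : Set
  LoopFree = ∀ e → proj₁ (ends e) ≢ proj₂ (ends e)

  Adj : Vtx → Vtx → Set
  Adj u w = ∃[ e ] ((proj₁ (ends e) ≡ u × proj₂ (ends e) ≡ w)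
                    ⊎ (proj₁ (ends e) ≡ w × proj₂ (ends e) ≡ u))

  Connected : Set
  Connected = ∀ u w → Star Adj u w

  inc : Fin m → Vtx → Bool
  inc e w = (proj₁ (ends e) == w) ∨ (proj₂ (ends e) == w)

  joins : Fin m → Vtx → Vtx → Bool
  joins e u w = ((proj₁ (ends e) == u) ∧ (proj₂ (ends e) == w))
              ∨ ((proj₁ (ends e) == w) ∧ (proj₂ (ends e) == u))

  deg : Fin n → ℕ
  deg v = Σᶠ (λ e → [ inc e (suc v) ])

  Config : Set
  Config = Fin n → ℕ

  Stable : Config → Set
  Stable η = ∀ v → η v ≤ deg v

  ηmax : Config
  ηmax v = deg v

  addGrain : Fin n → Config → Config
  addGrain v η y = if v == y then suc (η y) else η y

  -- stochastic toppling at x with Bernoulli outcomes B (only B e for edges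
  -- e incident to x matter): x loses Σ_{e∋x} B e grains, every y ∈ V gains
  -- Σ_{e={x,y}} B e grains (grains sent to the sink are lost).
  loss : Fin n → (Fin m → Bool) → ℕ
  loss x B = Σᶠ (λ e → [ B e ∧ inc e (suc x) ])

  gain : Fin n → (Fin m → Bool) → Fin n → ℕ
  gain x B y = Σᶠ (λ e → [ B e ∧ joins e (suc x) (suc y) ])

  topple : Fin n → (Fin m → Bool) → Config → Config
  topple x B η y = (if x == y then η y ∸ loss x B else η y) + gain x B y

  -- one legal stochastic toppling (any outcome B has positive probability
  -- since 0 < p < 1)
  ToppleStep : Config → Config → Set
  ToppleStep η η' = ∃[ x ] (deg x < η x × ∃[ B ] (∀ y → η' y ≡ topple x B η y))

  -- one transition of the Markov chain with positive probability:
  -- add a grain at some v ∈ V, then legal stochastic topplings until stable.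
  ChainStep : Config → Config → Set
  ChainStep η η' = ∃[ v ] ∃[ η'' ] (Star ToppleStep (addGrain v η) η''
                                     × (∀ y → η'' y ≡ η' y) × Stable η')

  -- Sto(G): the (recurrent) communicating class of ηmax in the chain.
  Sto : Config → Set
  Sto η = ∃[ η₁ ] ((∀ y → η₁ y ≡ η y)
                   × Star ChainStep ηmax η₁ × Star ChainStep η₁ ηmax)

  -- orientations: O e = true orients e from proj₁ to proj₂, false the reverse
  Orientation : Set
  Orientation = Fin m → Bool

  head : Orientation → Fin m → Vtx
  head O e = if O e then proj₂ (ends e) else proj₁ (ends e)

  indeg : Orientation → Vtx → ℕ
  indeg O w = Σᶠ (λ e → [ head O e == w ])

  -- η ∈ comp(O): η stable and in_O(v) ≥ 1 + l_η(v) for all v ∈ V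
  Comp : Orientation → Config → Set
  Comp O η = Stable η × (∀ v → suc (deg v ∸ η v) ≤ indeg O (suc v))

  𝒱 : Config → Set
  𝒱 η = ∃[ O ] Comp O η

module Submission where

-- One direction is free: from a stable η, adding grains one at a time never
-- forces a toppling, so ηmax is reached (`fill`).  The content is a path from
-- ηmax to η, built by induction on the number of unsaturated vertices.  The
-- invariant (`Invariant S O η`) is that η is saturated (η v = deg v) on a set
-- S whose vertices drain to the sink through S, and satisfies the
-- compatibility inequality deg v + 1 ≤ in_O(v) + η v off S.  If S ≠ V,
-- connectivity yields x ∉ S adjacent to S ∪ {s} (`frontier`).  Let ζ agree
-- with η except that x is saturated and every other unsaturated y loses the
-- grains that x would send back along the edges O orients from y into x.
-- Reversing those edges keeps ζ compatible, so ζ satisfies the invariant for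
-- S ∪ {x} and is reachable by induction.  From ζ, adding a grain at x,
-- toppling x along its incoming edges and draining the grains that land in S
-- (`drainAll`) is one chain step to a configuration below η; then `fill`.

open import Defs
open import Data.Nat using (ℕ; zero; suc; pred; _+_; _∸_; _≤_; _<_; z≤n; s≤s; ≢-nonZero)
open import Data.Nat.Properties
  using ( ≤-refl; ≤-trans; ≤-antisym; <⇒≤; +-identityʳ; +-comm; +-assoc; +-suc
        ; +-mono-≤; +-monoˡ-≤; +-cancelʳ-≤; ≤-reflexive; +-∸-assoc; m≤m+n; m∸n≤m; m∸n+n≡m; m+[n∸m]≡n
        ; m≤n+o⇒m∸n≤o; m∸n≢0⇒n<m; m∸n≡0⇒m≤n; m+n≡0⇒m≡0; m+n≡0⇒n≡0; 1+n≢0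
        ; suc-injective; suc-pred; +-0-commutativeMonoid; module ≤-Reasoning )
open import Data.Fin using (Fin; zero; suc; _≟_)
open import Data.Fin.Properties using () renaming (suc-injective to fsuc-injective)
open import Data.Bool using (Bool; true; false; if_then_else_; not)
open import Data.Product using (_×_; _,_; proj₁; proj₂; ∃-syntax)
open import Data.Sum using (_⊎_; inj₁; inj₂)
open import Data.Empty using (⊥-elim)
open import Function using (_∘_)
open import Relation.Nullary using (yes; no)
open import Relation.Nullary.Decidable using (dec-true; dec-false)
open import Relation.Binary.PropositionalEquality
  using (_≡_; _≢_; refl; sym; trans; cong; cong₂; subst; module ≡-Reasoning)
open import Relation.Binary.Construct.Closure.ReflexiveTransitive
  using (Star; ε; _◅_; _◅◅_)
open import Algebra.Properties.CommutativeMonoid.Sum +-0-commutativeMonoid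
  using (sum; ∑-distrib-+)

true≢false : true ≢ false
true≢false ()

==-refl : ∀ {k} (a : Fin k) → (a == a) ≡ true
==-refl a = dec-true (a ≟ a) refl

==-≢ : ∀ {k} {a b : Fin k} → a ≢ b → (a == b) ≡ false
==-≢ {a = a} {b} = dec-false (a ≟ b)

==-false⇒≢ : ∀ {k} {a b : Fin k} → (a == b) ≡ false → a ≢ b
==-false⇒≢ {a = a} a==b refl = true≢false (trans (sym (==-refl a)) a==b)

∧-falseʳ : ∀ a → a ∧ false ≡ false
∧-falseʳ true  = refl
∧-falseʳ false = refl

∨-falseʳ : ∀ a → a ∨ false ≡ a
∨-falseʳ true  = refl
∨-falseʳ false = refl

∨-trueʳ : ∀ a → a ∨ true ≡ true
∨-trueʳ true  = refl
∨-trueʳ false = refl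

∧-trueʳ : ∀ a → a ∧ true ≡ a
∧-trueʳ true  = refl
∧-trueʳ false = refl

∨-comm : ∀ a b → a ∨ b ≡ b ∨ a
∨-comm true  true  = refl
∨-comm true  false = refl
∨-comm false b     = sym (∨-falseʳ b)

∨≡false : ∀ a b → a ∨ b ≡ false → a ≡ false × b ≡ false
∨≡false false b b≡false = refl , b≡false

∧-absorbs-∨ : ∀ a b → a ∧ (a ∨ b) ≡ a
∧-absorbs-∨ true  b = refl
∧-absorbs-∨ false b = refl

∧-comm : ∀ a b → a ∧ b ≡ b ∧ a
∧-comm true  true  = refl
∧-comm true  false = refl
∧-comm false true  = refl
∧-comm false false = refl

∨∧-swap : ∀ p q r s → (p ∧ q) ∨ (r ∧ s) ≡ (s ∧ r) ∨ (q ∧ p)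
∨∧-swap p q r s = trans (∨-comm (p ∧ q) (r ∧ s)) (cong₂ _∨_ (∧-comm r s) (∧-comm p q))

[not]≢0 : ∀ {a} → [ not a ] ≢ 0 → a ≡ false
[not]≢0 {true}  1≡0 = ⊥-elim (1≡0 refl)
[not]≢0 {false} _   = refl

[]-≤-∨ : ∀ a b → [ a ] ≤ [ a ∨ b ]
[]-≤-∨ true  b = ≤-refl
[]-≤-∨ false b = z≤n

Σ-cong : ∀ {m} {f g : Fin m → ℕ} → (∀ i → f i ≡ g i) → Σᶠ f ≡ Σᶠ g
Σ-cong {zero}  _   = refl
Σ-cong {suc m} f≡g = cong₂ _+_ (f≡g zero) (Σ-cong (f≡g ∘ suc))

Σ-mono : ∀ {m} {f g : Fin m → ℕ} → (∀ i → f i ≤ g i) → Σᶠ f ≤ Σᶠ g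
Σ-mono {zero}  _   = z≤n
Σ-mono {suc m} f≤g = +-mono-≤ (f≤g zero) (Σ-mono (f≤g ∘ suc))

Σᶠ≡sum : ∀ {m} (f : Fin m → ℕ) → Σᶠ f ≡ sum f
Σᶠ≡sum {zero}  f = refl
Σᶠ≡sum {suc m} f = cong (f zero +_) (Σᶠ≡sum (f ∘ suc))

Σ-+ : ∀ {m} (f g : Fin m → ℕ) → Σᶠ (λ i → f i + g i) ≡ Σᶠ f + Σᶠ g
Σ-+ f g = begin
  Σᶠ (λ i → f i + g i)  ≡⟨ Σᶠ≡sum (λ i → f i + g i) ⟩
  sum (λ i → f i + g i) ≡⟨ ∑-distrib-+ f g ⟩
  sum f + sum g         ≡⟨ sym (cong₂ _+_ (Σᶠ≡sum f) (Σᶠ≡sum g)) ⟩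
  Σᶠ f + Σᶠ g           ∎
  where open ≡-Reasoning

Σ-zero : ∀ {m} {f : Fin m → ℕ} → (∀ i → f i ≡ 0) → Σᶠ f ≡ 0
Σ-zero {zero}  _    = refl
Σ-zero {suc m} f≡0 = cong₂ _+_ (f≡0 zero) (Σ-zero (f≡0 ∘ suc))

Σ-zero-inv : ∀ {m} (f : Fin m → ℕ) → Σᶠ f ≡ 0 → ∀ i → f i ≡ 0
Σ-zero-inv f Σ≡0 zero    = m+n≡0⇒m≡0 (f zero) Σ≡0
Σ-zero-inv f Σ≡0 (suc i) = Σ-zero-inv (f ∘ suc) (m+n≡0⇒n≡0 (f zero) Σ≡0) i

Σ-nonzero : ∀ {m} (f : Fin m → ℕ) → Σᶠ f ≢ 0 → ∃[ i ] (f i ≢ 0)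
Σ-nonzero {zero}  f Σ≢0 = ⊥-elim (Σ≢0 refl)
Σ-nonzero {suc m} f Σ≢0 with f zero in f₀
... | suc k = zero , λ f₀≡0 → 1+n≢0 {k} (trans (sym f₀) f₀≡0)
... | zero  with Σ-nonzero (f ∘ suc) Σ≢0
...   | i , fi≢0 = suc i , fi≢0

Σ-select : ∀ {m} (b : Fin m → Bool) (j : Fin m) → Σᶠ (λ i → [ (i == j) ∧ b i ]) ≡ [ b j ]
Σ-select {suc m} b zero = trans (cong ([ b zero ] +_) (Σ-zero {m} (λ _ → refl))) (+-identityʳ _)
Σ-select {suc m} b (suc j) = Σ-select (b ∘ suc) j

Σ-update : ∀ {m} {f g : Fin m → ℕ} (j : Fin m) → (∀ i → i ≢ j → f i ≡ g i) →
           f j ≡ suc (g j) → Σᶠ f ≡ suc (Σᶠ g)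
Σ-update zero    off at = cong₂ _+_ at (Σ-cong (λ i → off (suc i) (λ ())))
Σ-update (suc j) off at =
  trans (cong₂ _+_ (off zero (λ ())) (Σ-update j (λ i i≢j → off (suc i) (i≢j ∘ fsuc-injective)) at))
        (+-suc _ _)

crossing : ∀ {A : Set} {R : A → A → Set} (P : A → Bool) {a b} → Star R a b →
           P a ≡ false → P b ≡ true → ∃[ u ] ∃[ w ] (R u w × P u ≡ false × P w ≡ true)
crossing P ε                  Pa Pb = ⊥-elim (true≢false (trans (sym Pb) Pa))
crossing P (_◅_ {j = w} r rs) Pa Pb with P w in Pw
... | true  = _ , w , r , Pa , Pw
... | false = crossing P rs Pw Pb

links : ∀ {k} → Fin k → Fin k → Fin k → Fin k → Bool
links h t u w = ((h == u) ∧ (t == w)) ∨ ((h == w) ∧ (t == u))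

-- Below, an edge has head h and tail t, and "fired" means that it is one of
-- the edges with head u, which u topples along, sending a grain to the tail.
-- A fired edge costs u one grain:
fired-loss : ∀ {k} (h t u : Fin k) → [ (h == u) ∧ ((h == u) ∨ (t == u)) ] ≡ [ h == u ]
fired-loss h t u = cong [_] (∧-absorbs-∨ (h == u) (t == u))

-- it never returns its grain to u (no loops):
fired-self : ∀ {k} {h t : Fin k} (u : Fin k) → h ≢ t → (h == u) ∧ links h t u u ≡ false
fired-self {h = h} {t} u h≢t with h ≟ u
... | yes refl rewrite ==-≢ (h≢t ∘ sym) = refl
... | no _     = refl

-- at w ≠ u, the grains sent to w and the edges already into w are edges at w:
fired-deg : ∀ {k} (h t : Fin k) {u w} → u ≢ w →
            [ (h == u) ∧ links h t u w ] + [ h == w ] ≤ [ (h == w) ∨ (t == w) ]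
fired-deg h t {u} {w} u≢w with h ≟ u
... | yes refl rewrite ==-≢ u≢w | ∨-falseʳ (t == w) | +-identityʳ [ t == w ] = ≤-refl
... | no _     = []-≤-∨ (h == w) (t == w)

-- and reversing the fired edges turns each grain sent to w into an edge into w.
fired-reverse : ∀ {k} (h t : Fin k) {u w} → u ≢ w →
                [ (if h == u then t else h) == w ] ≡ [ h == w ] + [ (h == u) ∧ links h t u w ]
fired-reverse h t {u} {w} u≢w with h ≟ u
... | yes refl rewrite ==-≢ u≢w | ∨-falseʳ (t == w) = refl
... | no _     = sym (+-identityʳ _)

module Sandpile (G : Graph) where
  open Graph G

  -- Pointwise equality of configurations (stands in for function equality).
  _≈_ : Config G → Config G → Set
  ξ ≈ ζ = ∀ y → ξ y ≡ ζ y

  _⟶*_ : Config G → Config G → Set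
  a ⟶* b = ∃[ b' ] (Star (ToppleStep G) a b' × b' ≈ b)

  _⇒*_ : Config G → Config G → Set
  a ⇒* b = ∃[ b' ] (Star (ChainStep G) a b' × b' ≈ b)

  toppleStep-resp : ∀ {a a' b} → a ≈ a' → ToppleStep G a b → ToppleStep G a' b
  toppleStep-resp a≈a' (x , legal , B , outcome) =
    x , subst (deg G x <_) (a≈a' x) legal , B ,
    λ y → trans (outcome y)
                (cong (λ t → (if x == y then t ∸ loss G x B else t) + gain G x B y) (a≈a' y))

  ⟶*-resp : ∀ {a a' b} → a ≈ a' → a ⟶* b → a' ⟶* b
  ⟶*-resp a≈a' (_ , ε      , a≈b) = _ , ε , λ y → trans (sym (a≈a' y)) (a≈b y)
  ⟶*-resp a≈a' (_ , t ◅ ts , c≈b) = _ , toppleStep-resp a≈a' t ◅ ts , c≈b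

  ⟶*-cons : ∀ {a b c} → ToppleStep G a b → b ⟶* c → a ⟶* c
  ⟶*-cons t (_ , ts , d≈c) = _ , t ◅ ts , d≈c

  ⟶*-trans : ∀ {a b c} → a ⟶* b → b ⟶* c → a ⟶* c
  ⟶*-trans (_ , ts , b'≈b) b⟶*c with ⟶*-resp (λ y → sym (b'≈b y)) b⟶*c
  ... | _ , us , c'≈c = _ , ts ◅◅ us , c'≈c

  addGrain-here : ∀ v ξ → addGrain G v ξ v ≡ suc (ξ v)
  addGrain-here v ξ rewrite ==-refl v = refl

  addGrain-elsewhere : ∀ {v y} ξ → v ≢ y → addGrain G v ξ y ≡ ξ y
  addGrain-elsewhere ξ v≢y rewrite ==-≢ v≢y = refl

  addGrain-resp : ∀ v {a a'} → a ≈ a' → addGrain G v a ≈ addGrain G v a'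
  addGrain-resp v a≈a' y = cong (λ t → if v == y then suc t else t) (a≈a' y)

  chainStep-resp : ∀ {a a' c} → a ≈ a' → ChainStep G a c → ChainStep G a' c
  chainStep-resp a≈a' (v , _ , ts , b≈c , stable)
    with ⟶*-resp (addGrain-resp v a≈a') (_ , ts , λ _ → refl)
  ... | _ , ts' , b'≈b = v , _ , ts' , (λ y → trans (b'≈b y) (b≈c y)) , stable

  ⇒*-continue : ∀ {a b c d} → a ⇒* b → ChainStep G b c →
                c ≈ d ⊎ Star (ChainStep G) c d → a ⇒* d
  ⇒*-continue (_ , ps , b'≈b) step (inj₁ c≈d) = _ , ps ◅◅ (step' ◅ ε) , c≈d
    where step' = chainStep-resp (λ y → sym (b'≈b y)) step
  ⇒*-continue (_ , ps , b'≈b) step (inj₂ qs)  = _ , ps ◅◅ (step' ◅ qs) , λ _ → refl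
    where step' = chainStep-resp (λ y → sym (b'≈b y)) step

  -- Filling up: a stable η above ξ is reached from ξ by grain additions that
  -- trigger no toppling (by induction on the total gap k).
  fill : ∀ k {ξ η} → Σᶠ (λ y → η y ∸ ξ y) ≡ k → (∀ y → ξ y ≤ η y) → Stable G η →
         ξ ≈ η ⊎ Star (ChainStep G) ξ η
  fill zero    {ξ} {η} gap≡0 ξ≤η _ =
    inj₁ (λ y → ≤-antisym (ξ≤η y) (m∸n≡0⇒m≤n (Σ-zero-inv (λ y → η y ∸ ξ y) gap≡0 y)))
  fill (suc k) {ξ} {η} gap≡k ξ≤η η-stable
    with Σ-nonzero (λ y → η y ∸ ξ y) (λ gap≡0 → 1+n≢0 (trans (sym gap≡k) gap≡0))
  ... | v , gap-v = continue (fill k (suc-injective (trans (sym shrink) gap≡k)) ξ'≤η η-stable)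
    where
    ξ' = addGrain G v ξ
    ξ'≤η : ∀ y → ξ' y ≤ η y
    ξ'≤η y with v ≟ y
    ... | yes refl = m∸n≢0⇒n<m gap-v
    ... | no _     = ξ≤η y
    shrink : Σᶠ (λ y → η y ∸ ξ y) ≡ suc (Σᶠ (λ y → η y ∸ ξ' y))
    shrink = Σ-update v (λ y y≢v → cong (η y ∸_) (sym (addGrain-elsewhere ξ (y≢v ∘ sym))))
                        (trans (+-∸-assoc 1 {η v} {suc (ξ v)} (m∸n≢0⇒n<m gap-v))
                               (cong (λ t → suc (η v ∸ t)) (sym (addGrain-here v ξ))))
    ξ'-stable : Stable G ξ'
    ξ'-stable y = ≤-trans (ξ'≤η y) (η-stable y)
    continue : ξ' ≈ η ⊎ Star (ChainStep G) ξ' η → ξ ≈ η ⊎ Star (ChainStep G) ξ η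
    continue (inj₁ ξ'≈η) = inj₂ ((v , ξ' , ε , ξ'≈η , η-stable) ◅ ε)
    continue (inj₂ path) = inj₂ ((v , ξ' , ε , (λ _ → refl) , ξ'-stable) ◅ path)

  toMax : ∀ {ξ} → Stable G ξ → ξ ≈ ηmax G ⊎ Star (ChainStep G) ξ (ηmax G)
  toMax ξ-stable = fill _ refl ξ-stable (λ _ → ≤-refl)

  Ends : Fin m → Vtx G → Vtx G → Set
  Ends e a b = (proj₁ (ends e) ≡ a × proj₂ (ends e) ≡ b)
             ⊎ (proj₁ (ends e) ≡ b × proj₂ (ends e) ≡ a)

  -- Drop one grain at a vertex of G; a grain dropped at the sink is lost.
  deposit : Vtx G → Config G → Config G
  deposit t ξ y = ξ y + [ t == suc y ]

  addGrain≈deposit : ∀ v ξ → addGrain G v ξ ≈ deposit (suc v) ξ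
  addGrain≈deposit v ξ y with v ≟ y
  ... | yes refl = +-comm 1 (ξ v)
  ... | no _     = sym (+-identityʳ (ξ y))

  only : Fin m → Fin m → Bool
  only e e' = e' == e

  inSinkOr : (Fin n → Bool) → Vtx G → Bool
  inSinkOr S zero    = true
  inSinkOr S (suc v) = S v

  data Drains (S : Fin n → Bool) : Fin n → Set where
    toSink : ∀ {v} e → Ends e (suc v) zero → Drains S v
    via    : ∀ {v w} e → Ends e (suc v) (suc w) → S w ≡ true → Drains S w → Drains S v

  Drains-mono : ∀ {S S'} → (∀ w → S w ≡ true → S' w ≡ true) → ∀ {v} → Drains S v → Drains S' v
  Drains-mono S⊆S' (toSink e e-ends)        = toSink e e-ends
  Drains-mono S⊆S' (via e e-ends S-w drains) = via e e-ends (S⊆S' _ S-w) (Drains-mono S⊆S' drains)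

  module _ (lf : LoopFree G) where

    Ends-inc : ∀ {e a b} → Ends e a b → inc G e a ≡ true
    Ends-inc {e} (inj₁ (refl , refl)) rewrite ==-refl (proj₁ (ends e)) = refl
    Ends-inc {e} (inj₂ (refl , refl)) rewrite ==-refl (proj₂ (ends e)) = ∨-trueʳ _

    Ends-joins : ∀ {e a b} → Ends e a b → ∀ c → joins G e a c ≡ (b == c)
    Ends-joins {e} (inj₁ (refl , refl)) c
      rewrite ==-refl (proj₁ (ends e)) | ==-≢ (lf e ∘ sym) | ∧-falseʳ (proj₁ (ends e) == c)
      = ∨-falseʳ _
    Ends-joins {e} (inj₂ (refl , refl)) c
      rewrite ==-refl (proj₂ (ends e)) | ==-≢ (lf e) = ∧-trueʳ _

    fire : ∀ {e v t ξ ζ} → Ends e (suc v) t → deg G v ≤ ξ v → ζ ≈ deposit t ξ →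
           ToppleStep G (addGrain G v ξ) ζ
    fire {e} {v} {t} {ξ} {ζ} e-ends deg≤ξ ζ≈ = v , legal , only e , outcome
      where
      legal : deg G v < addGrain G v ξ v
      legal = subst (deg G v <_) (sym (addGrain-here v ξ)) (s≤s deg≤ξ)
      lost : loss G v (only e) ≡ 1
      lost = trans (Σ-select (λ e' → inc G e' (suc v)) e) (cong [_] (Ends-inc e-ends))
      gained : ∀ y → gain G v (only e) y ≡ [ t == suc y ]
      gained y = trans (Σ-select (λ e' → joins G e' (suc v) (suc y)) e)
                       (cong [_] (Ends-joins e-ends (suc y)))
      kept : ∀ y → (if v == y then addGrain G v ξ y ∸ loss G v (only e) else addGrain G v ξ y) ≡ ξ y
      kept y rewrite lost with v ≟ y
      ... | yes refl = refl
      ... | no _     = refl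
      outcome : ∀ y → ζ y ≡ topple G v (only e) (addGrain G v ξ) y
      outcome y = trans (ζ≈ y) (sym (cong₂ _+_ (kept y) (gained y)))

    drainGrain : ∀ {S v ξ} → Drains S v → (∀ w → S w ≡ true → deg G w ≤ ξ w) → deg G v ≤ ξ v →
                 addGrain G v ξ ⟶* ξ
    drainGrain (toSink e e-ends) full deg≤ξ =
      _ , fire e-ends deg≤ξ (λ y → sym (+-identityʳ _)) ◅ ε , λ _ → refl
    drainGrain {ξ = ξ} (via {w = w} e e-ends S-w drains) full deg≤ξ =
      ⟶*-cons (fire e-ends deg≤ξ (addGrain≈deposit w ξ)) (drainGrain drains full (full w S-w))

    drainAll : ∀ {S} k (ξ tok : Config G) → Σᶠ tok ≡ k → (∀ y → S y ≡ false → tok y ≡ 0) →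
               (∀ y → S y ≡ true → deg G y ≤ ξ y) → (∀ y → S y ≡ true → Drains S y) →
               (λ y → ξ y + tok y) ⟶* ξ
    drainAll zero ξ tok Σ≡0 _ _ _ =
      _ , ε , λ y → trans (cong (ξ y +_) (Σ-zero-inv tok Σ≡0 y)) (+-identityʳ _)
    drainAll {S} (suc k) ξ tok Σ≡k outside full drains
      with Σ-nonzero tok (λ Σ≡0 → 1+n≢0 (trans (sym Σ≡k) Σ≡0))
    ... | y₀ , tok≢0 =
      ⟶*-resp source (⟶*-trans (drainGrain (drains y₀ S-y₀) full' (full' y₀ S-y₀))
                               (drainAll k ξ tok' (suc-injective (trans (sym shrink) Σ≡k))
                                         outside' full drains))
      where
      instance _ = ≢-nonZero tok≢0
      tok' : Config G
      tok' y = if y₀ == y then pred (tok y) else tok y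
      S-y₀ : S y₀ ≡ true
      S-y₀ with S y₀ in S-y₀≡
      ... | true  = refl
      ... | false = ⊥-elim (tok≢0 (outside y₀ S-y₀≡))
      shrink : Σᶠ tok ≡ suc (Σᶠ tok')
      shrink = Σ-update y₀ unchanged lowered
        where
        unchanged : ∀ y → y ≢ y₀ → tok y ≡ tok' y
        unchanged y y≢y₀ rewrite ==-≢ (y≢y₀ ∘ sym) = refl
        lowered : tok y₀ ≡ suc (tok' y₀)
        lowered rewrite ==-refl y₀ = sym (suc-pred (tok y₀))
      outside' : ∀ y → S y ≡ false → tok' y ≡ 0
      outside' y S-y with y₀ ≟ y
      ... | yes refl = ⊥-elim (true≢false (trans (sym S-y₀) S-y))
      ... | no _     = outside y S-y
      full' : ∀ w → S w ≡ true → deg G w ≤ ξ w + tok' w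
      full' w S-w = ≤-trans (full w S-w) (m≤m+n _ _)
      source : addGrain G y₀ (λ y → ξ y + tok' y) ≈ (λ y → ξ y + tok y)
      source y with y₀ ≟ y
      ... | yes refl = trans (sym (+-suc (ξ y₀) _)) (cong (ξ y₀ +_) (suc-pred (tok y₀)))
      ... | no _     = refl

  tail : Orientation G → Fin m → Vtx G
  tail O e = if O e then proj₁ (ends e) else proj₂ (ends e)

  inc-oriented : ∀ O e w → inc G e w ≡ (head G O e == w) ∨ (tail O e == w)
  inc-oriented O e w with O e
  ... | true  = ∨-comm (proj₁ (ends e) == w) (proj₂ (ends e) == w)
  ... | false = refl

  joins-oriented : ∀ O e u w → joins G e u w ≡ links (head G O e) (tail O e) u w
  joins-oriented O e u w with O e
  ... | true  = ∨∧-swap (proj₁ (ends e) == u) (proj₂ (ends e) == w)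
                        (proj₁ (ends e) == w) (proj₂ (ends e) == u)
  ... | false = refl

  into : Orientation G → Vtx G → Fin m → Bool
  into O u e = head G O e == u

  reverseInto : Orientation G → Vtx G → Orientation G
  reverseInto O u e = if into O u e then not (O e) else O e

  head-reverseInto : ∀ O u e →
    head G (reverseInto O u) e ≡ (if head G O e == u then tail O e else head G O e)
  head-reverseInto O u e with O e
  ... | true  with proj₂ (ends e) == u
  ...   | true  = refl
  ...   | false = refl
  head-reverseInto O u e | false with proj₁ (ends e) == u
  ...   | true  = refl
  ...   | false = refl

  module _ (lf : LoopFree G) where

    head≢tail : ∀ O e → head G O e ≢ tail O e
    head≢tail O e with O e
    ... | true  = lf e ∘ sym
    ... | false = lf e

    loss-into : ∀ O x → loss G x (into O (suc x)) ≡ indeg G O (suc x)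
    loss-into O x = Σ-cong λ e →
      trans (cong (λ b → [ into O (suc x) e ∧ b ]) (inc-oriented O e (suc x)))
            (fired-loss (head G O e) (tail O e) (suc x))

    gain-into-self : ∀ O x → gain G x (into O (suc x)) x ≡ 0
    gain-into-self O x = Σ-zero λ e → cong [_]
      (trans (cong (into O (suc x) e ∧_) (joins-oriented O e (suc x) (suc x)))
             (fired-self (suc x) (head≢tail O e)))

    gain-into-bound : ∀ O {x y} → x ≢ y →
                      gain G x (into O (suc x)) y + indeg G O (suc y) ≤ deg G y
    gain-into-bound O {x} {y} x≢y =
      subst (_≤ deg G y) (Σ-+ (λ e → [ into O (suc x) e ∧ joins G e (suc x) (suc y) ])
                              (λ e → [ head G O e == suc y ]))
            (Σ-mono per-edge)
      where
      per-edge : ∀ e → [ into O (suc x) e ∧ joins G e (suc x) (suc y) ] + [ head G O e == suc y ]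
                       ≤ [ inc G e (suc y) ]
      per-edge e rewrite joins-oriented O e (suc x) (suc y) | inc-oriented O e (suc y) =
        fired-deg (head G O e) (tail O e) (x≢y ∘ fsuc-injective)

    indeg-reverseInto : ∀ O {x y} → x ≢ y →
      indeg G (reverseInto O (suc x)) (suc y) ≡ indeg G O (suc y) + gain G x (into O (suc x)) y
    indeg-reverseInto O {x} {y} x≢y =
      trans (Σ-cong per-edge) (Σ-+ (λ e → [ head G O e == suc y ])
                                   (λ e → [ into O (suc x) e ∧ joins G e (suc x) (suc y) ]))
      where
      per-edge : ∀ e → [ head G (reverseInto O (suc x)) e == suc y ]
                       ≡ [ head G O e == suc y ] + [ into O (suc x) e ∧ joins G e (suc x) (suc y) ]
      per-edge e rewrite head-reverseInto O (suc x) e | joins-oriented O e (suc x) (suc y) =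
        fired-reverse (head G O e) (tail O e) (x≢y ∘ fsuc-injective)

  record Invariant (S : Fin n → Bool) (O : Orientation G) (η : Config G) : Set where
    field
      stable     : Stable G η
      saturated  : ∀ v → S v ≡ true → η v ≡ deg G v
      compatible : ∀ v → S v ≡ false → suc (deg G v) ≤ indeg G O (suc v) + η v
      drains     : ∀ v → S v ≡ true → Drains S v

  initial : ∀ {O η} → Comp G O η → Invariant (λ _ → false) O η
  initial {O} {η} (η-stable , η-compatible) = record
    { stable     = η-stable
    ; saturated  = λ _ ()
    ; compatible = λ v _ → additive v
    ; drains     = λ _ ()
    }
    where
    additive : ∀ v → suc (deg G v) ≤ indeg G O (suc v) + η v
    additive v = begin
      suc (deg G v)              ≡⟨ cong suc (sym (m∸n+n≡m (η-stable v))) ⟩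
      suc (deg G v ∸ η v) + η v  ≤⟨ +-monoˡ-≤ (η v) (η-compatible v) ⟩
      indeg G O (suc v) + η v    ∎
      where open ≤-Reasoning

  insert : Fin n → (Fin n → Bool) → Fin n → Bool
  insert x S y = (x == y) ∨ S y

  unsaturated : (Fin n → Bool) → ℕ
  unsaturated S = Σᶠ (λ v → [ not (S v) ])

  unsaturated-insert : ∀ {S x} → S x ≡ false → unsaturated S ≡ suc (unsaturated (insert x S))
  unsaturated-insert {S} {x} S-x = Σ-update x unchanged added
    where
    unchanged : ∀ y → y ≢ x → [ not (S y) ] ≡ [ not (insert x S y) ]
    unchanged y y≢x rewrite ==-≢ (y≢x ∘ sym) = refl
    added : [ not (S x) ] ≡ suc [ not (insert x S x) ]
    added rewrite S-x | ==-refl x = refl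

  frontier : Connected G → ∀ {S v} → S v ≡ false →
             ∃[ x ] (S x ≡ false × ∃[ e ] ∃[ t ] (Ends e (suc x) t × inSinkOr S t ≡ true))
  frontier conn {S} {v} S-v with crossing (inSinkOr S) (conn (suc v) zero) S-v refl
  ... | zero  , _ , _            , ()  , _
  ... | suc x , t , (e , e-ends) , S-x , S-t = x , S-x , e , t , e-ends , S-t

  module _ (lf : LoopFree G) where

    module Saturate {S O η} (inv : Invariant S O η) {x e t} (S-x : S x ≡ false)
                    (e-ends : Ends e (suc x) t) (S-t : inSinkOr S t ≡ true) where
      open Invariant inv

      sent : Fin n → ℕ
      sent = gain G x (into O (suc x))

      S' : Fin n → Bool
      S' = insert x S

      O' : Orientation G
      O' = reverseInto O (suc x)

      -- η with x saturated and the grains x will send to unsaturated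
      -- vertices removed in advance
      ζ : Config G
      ζ y = if S' y then deg G y else η y ∸ sent y

      -- the outcome of the chain step from ζ: η with x lowered to what
      -- remains after x fires all its incoming edges
      η' : Config G
      η' y = if x == y then suc (deg G x) ∸ indeg G O (suc x) else η y

      -- Compatibility at y leaves room for the grains sent to y.
      sent<η : ∀ {y} → S y ≡ false → x ≢ y → sent y < η y
      sent<η {y} S-y x≢y = +-cancelʳ-≤ (indeg G O (suc y)) (suc (sent y)) (η y) (begin
        suc (sent y + indeg G O (suc y)) ≤⟨ s≤s (gain-into-bound lf O x≢y) ⟩
        suc (deg G y)                    ≤⟨ compatible y S-y ⟩
        indeg G O (suc y) + η y          ≡⟨ +-comm (indeg G O (suc y)) (η y) ⟩
        η y + indeg G O (suc y)          ∎)
        where open ≤-Reasoning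

      S⊆S' : ∀ w → S w ≡ true → S' w ≡ true
      S⊆S' w S-w rewrite S-w = ∨-trueʳ (x == w)

      x-drains : ∀ u → Ends e (suc x) u → inSinkOr S u ≡ true → Drains S' x
      x-drains zero    ends-u _   = toSink e ends-u
      x-drains (suc w) ends-u S-w = via e ends-u (S⊆S' w S-w) (Drains-mono S⊆S' (drains w S-w))

      -- Reversal gains at y exactly what ζ removed there.
      ζ-compatible : ∀ y → S' y ≡ false → suc (deg G y) ≤ indeg G O' (suc y) + ζ y
      ζ-compatible y S'-y with ∨≡false (x == y) (S y) S'-y
      ... | x≠y , S-y rewrite S'-y = begin
        suc (deg G y)                                  ≤⟨ compatible y S-y ⟩
        indeg G O (suc y) + η y
          ≡⟨ cong (indeg G O (suc y) +_) (sym (m+[n∸m]≡n sent≤η)) ⟩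
        indeg G O (suc y) + (sent y + (η y ∸ sent y))
          ≡⟨ sym (+-assoc (indeg G O (suc y)) (sent y) _) ⟩
        indeg G O (suc y) + sent y + (η y ∸ sent y)
          ≡⟨ cong (_+ (η y ∸ sent y)) (sym (indeg-reverseInto lf O x≢y)) ⟩
        indeg G O' (suc y) + (η y ∸ sent y)            ∎
        where
        open ≤-Reasoning
        x≢y = ==-false⇒≢ x≠y
        sent≤η = <⇒≤ (sent<η S-y x≢y)

      ζ-invariant : Invariant S' O' ζ
      ζ-invariant = record
        { stable     = ζ-stable
        ; saturated  = ζ-saturated
        ; compatible = ζ-compatible
        ; drains     = ζ-drains
        }
        where
        ζ-stable : Stable G ζ
        ζ-stable y with S' y
        ... | true  = ≤-refl
        ... | false = ≤-trans (m∸n≤m (η y) (sent y)) (stable y)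
        ζ-saturated : ∀ y → S' y ≡ true → ζ y ≡ deg G y
        ζ-saturated y S'-y rewrite S'-y = refl
        ζ-drains : ∀ y → S' y ≡ true → Drains S' y
        ζ-drains y S'-y with x ≟ y
        ... | yes refl = x-drains t e-ends S-t
        ... | no _     = Drains-mono S⊆S' (drains y S'-y)

      -- Compatibility at x: x has at least deg x + 1 - η x incoming edges.
      η'≤η : ∀ y → η' y ≤ η y
      η'≤η y with x ≟ y
      ... | yes refl = m≤n+o⇒m∸n≤o (suc (deg G x)) (indeg G O (suc x)) (compatible x S-x)
      ... | no _     = ≤-refl

      -- the grains x sends into S, which still have to drain away
      tok : Config G
      tok y = if S y then sent y else 0

      -- The grain added at x makes it unstable; firing its incoming edges
      -- restores η off S ∪ {x} and leaves the tokens on S.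
      fire-x : ToppleStep G (addGrain G x ζ) (λ y → η' y + tok y)
      fire-x = x , legal , into O (suc x) , outcome
        where
        legal : deg G x < addGrain G x ζ x
        legal rewrite ==-refl x = ≤-refl
        outcome : ∀ y → η' y + tok y ≡ topple G x (into O (suc x)) (addGrain G x ζ) y
        outcome y with x ≟ y
        ... | yes refl rewrite S-x | loss-into lf O x | gain-into-self lf O x = refl
        ... | no x≢y with S y in S-y
        ...   | true  = cong (_+ sent y) (saturated y S-y)
        ...   | false = trans (+-identityʳ (η y)) (sym (m∸n+n≡m (<⇒≤ (sent<η S-y x≢y))))

      tok-outside : ∀ y → S y ≡ false → tok y ≡ 0
      tok-outside y S-y rewrite S-y = refl

      η'-full : ∀ y → S y ≡ true → deg G y ≤ η' y
      η'-full y S-y with x ≟ y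
      ... | yes refl = ⊥-elim (true≢false (trans (sym S-y) S-x))
      ... | no _     = ≤-reflexive (sym (saturated y S-y))

      step : ChainStep G ζ η'
      step with drainAll lf (Σᶠ tok) η' tok refl tok-outside η'-full drains
      ... | _ , drained , ≈η' =
        x , _ , fire-x ◅ drained , ≈η' , λ y → ≤-trans (η'≤η y) (stable y)

    reach : Connected G → ∀ k {S O η} → unsaturated S ≡ k → Invariant S O η → ηmax G ⇒* η
    reach conn zero {S} none inv = ηmax G , ε , λ y → sym (saturated y (all-saturated y))
      where
      open Invariant inv
      all-saturated : ∀ y → S y ≡ true
      all-saturated y with S y | Σ-zero-inv (λ v → [ not (S v) ]) none y
      ... | true  | _  = refl
      ... | false | ()
    reach conn (suc k) {S} some inv
      with Σ-nonzero (λ v → [ not (S v) ]) (λ none → 1+n≢0 (trans (sym some) none))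
    ... | v , unsat-v with frontier conn ([not]≢0 unsat-v)
    ...   | x , S-x , e , t , e-ends , S-t =
      ⇒*-continue (reach conn k fewer ζ-invariant) step (fill _ refl η'≤η stable)
      where
      open Saturate inv S-x e-ends S-t
      open Invariant inv using (stable)
      fewer : unsaturated S' ≡ k
      fewer = suc-injective (trans (sym (unsaturated-insert S-x)) some)

open Sandpile using (reach; initial; toMax)

lemma4p2 : (G : Graph) → LoopFree G → Connected G →
           (η : Config G) → 𝒱 G η → Sto G η
lemma4p2 G lf conn η (O , compatible) with reach G lf conn _ refl (initial G {O} compatible)
... | η₁ , up , η₁≈η with toMax G (λ v → subst (_≤ deg G v) (sym (η₁≈η v)) (proj₁ compatible v))
...   | inj₁ η₁≈max = ηmax G , (λ y → trans (sym (η₁≈max y)) (η₁≈η y)) , ε , ε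
...   | inj₂ down   = η₁ , η₁≈η , up , down
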